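{- Let $p\geq 3$, $0\leq a,d\leq p-1$, $m\geq 3$, and let $A\in\mathrm{Avoid}(m,3,F(a,p,p,d))$ with a standard decomposition $A=[B\mid C]$ and associated directed graph $T$ (as defined in the context, for some fixed choice of associated vectors). If $|B|>2^m+m2^{m-1}-2^{m-3}$, then $T$ is transitive, i.e. whenever $ij$ and $jk$ are edges of $T$ with $i,j,k$ distinct, $ik$ is also an edge of $T$.
   Context: An $s$-matrix has entries in $\{0,\dots,s-1\}$; it is simple if it has no repeated columns; $|A|$ is its number of columns. $F\prec A$ means some submatrix of $A$ is a row and column permutation of $F$; $\mathrm{Avoid}(m,s,F)$ is the set of $m$-rowed simple $s$-matrices $A$ with $F\not\prec A$. $F(a,b,c,d)$ is the $2$-rowed $(0,1)$-matrix with $a$ columns $\binom00$, $b$ columns $\binom10$, $c$ columns $\binom01$, $d$ columns $\binom11$ (top entry first). For $A\in\mathrm{Avoid}(m,3,F(a,p,p,d))$, to each pair $1\leq i<j\leq m$ associate a vector $\binom{x}{y}\in\{\binom00,\binom01,\binom10,\binom11\}$ such that: if $\binom xy\in\{\binom01,\binom10\}$, rows $i,j$ of $A$ contain at most $p-1$ columns whose entries in rows $i,j$ are $x,y$; if $\binom xy=\binom00$, at most $a-1$ such columns; if $\binom xy=\binom11$, at most $d-1$ such columns (such a vector exists since $F(a,p,p,d)\not\prec A$; if several are possible one is chosen arbitrarily). A column $v$ has a mark at $(i,j)$ if $v_i=x$ and $v_j=y$ for the vector $\binom xy$ associated with $(i,j)$. $B$ is the matrix of all columns of $A$ with no mark,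 $C$ the matrix of columns with at least one mark; $A=[B\mid C]$ is the standard decomposition. The directed graph $T$ on $[m]$ has, for each pair $i<j$, the edge $ij$ if $(i,j)$ is associated with $\binom01$, the edge $ji$ if associated with $\binom10$, and no edge otherwise. -}

module Defs where

open import Data.Nat using (ℕ; _≤_; _<_)
open import Data.Bool using (Bool; true; false)
open import Data.Fin as Fin using (Fin; zero; suc; _≟_)
open import Data.Vec using (Vec; lookup)
open import Data.List using (List; length; filter)
open import Data.List.Relation.Unary.Unique.Propositional using (Unique)
open import Data.Product using (_×_; _,_; ∃-syntax; proj₁; proj₂)
open import Data.Sum using (_⊎_)
open import Relation.Nullary using (¬_; Dec; _×-dec_; _→-dec_; ¬?)
open import Data.Fin.Properties using (all?)
open import Relation.Binary.PropositionalEquality using (_≡_; _≢_)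

Column : ℕ → Set
Column m = Vec (Fin 3) m

Matrix : ℕ → Set
Matrix m = List (Column m)

Simple : ∀ {m} → Matrix m → Set
Simple A = Unique A

bit : Bool → Fin 3
bit false = zero
bit true  = suc zero

count : ∀ {m} → Matrix m → Fin m → Fin m → Fin 3 → Fin 3 → ℕ
count A i j x y = length (filter (λ v → (lookup v i ≟ x) ×-dec (lookup v j ≟ y)) A)

-- F(a,b,c,d) ≺ A for the 2-rowed (0,1)-matrix F(a,b,c,d): there are two distinct
-- rows i, j (in either order, accounting for row permutations) and disjoint sets of
-- columns realizing a columns (0,0), b columns (1,0), c columns (0,1), d columns (1,1)
-- (top entry = row i).  Since the entries determine the column types, this is
-- equivalent to the counts being large enough.
_≺F_ : ∀ {m} → (ℕ × ℕ × ℕ × ℕ) → Matrix m → Set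
_≺F_ {m} (a , b , c , d) A =
  ∃[ i ] ∃[ j ] (i ≢ j ×
     a ≤ count A i j (bit false) (bit false) ×
     b ≤ count A i j (bit true)  (bit false) ×
     c ≤ count A i j (bit false) (bit true)  ×
     d ≤ count A i j (bit true)  (bit true))

-- A choice of associated vector (x,y) for each pair i < j.  For convenience it is a
-- function on all ordered pairs, but only its values at pairs i < j are ever used.
Assoc : ℕ → Set
Assoc m = Fin m → Fin m → Bool × Bool

bound : ℕ → ℕ → ℕ → Bool × Bool → ℕ
bound a p d (false , false) = a
bound a p d (true  , false) = p
bound a p d (false , true)  = p
bound a p d (true  , true)  = d

ValidAssoc : ∀ {m} → ℕ → ℕ → ℕ → Matrix m → Assoc m → Set
ValidAssoc {m} a p d A σ =
  (i j : Fin m) → i Fin.< j →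
  count A i j (bit (proj₁ (σ i j))) (bit (proj₂ (σ i j))) < bound a p d (σ i j)

MarkAt : ∀ {m} → Assoc m → Column m → Fin m → Fin m → Set
MarkAt σ v i j = lookup v i ≡ bit (proj₁ (σ i j)) × lookup v j ≡ bit (proj₂ (σ i j))

markAt? : ∀ {m} (σ : Assoc m) (v : Column m) (i j : Fin m) → Dec (MarkAt σ v i j)
markAt? σ v i j = (lookup v i ≟ bit (proj₁ (σ i j))) ×-dec (lookup v j ≟ bit (proj₂ (σ i j)))

NoMark : ∀ {m} → Assoc m → Column m → Set
NoMark {m} σ v = (i j : Fin m) → i Fin.< j → ¬ MarkAt σ v i j

noMark? : ∀ {m} (σ : Assoc m) (v : Column m) → Dec (NoMark σ v)
noMark? σ v = all? (λ i → all? (λ j → (i Fin.<? j) →-dec ¬? (markAt? σ v i j)))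

B-part : ∀ {m} → Assoc m → Matrix m → Matrix m
B-part σ A = filter (noMark? σ) A

Edge : ∀ {m} → Assoc m → Fin m → Fin m → Set
Edge σ u v = (u Fin.< v × σ u v ≡ (false , true)) ⊎ (v Fin.< u × σ v u ≡ (true , false))

TransitiveT : ∀ {m} → Assoc m → Set
TransitiveT {m} σ = (i j k : Fin m) → i ≢ j → j ≢ k → i ≢ k →
  Edge σ i j → Edge σ j k → Edge σ i k

{-# OPTIONS --safe #-}
-- Count the unmarked columns of {0,1,2}^m; B consists of such columns.  Deleting a row r maps
-- unmarked columns to unmarked columns, and an unmarked restriction w has at most two unmarked
-- extensions unless its extensions by 0 and by 1 are both unmarked.  Such a w must avoid, in
-- every row j, the value that completes a mark at (r, j) in one of these two extensions, so
-- there are at most 2^(m-1) of them and N(m) ≤ 2 N(m-1) + 2^(m-1) ≤ 2^m + m 2^(m-1).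
-- If T is not transitive, some triple r, s, t has a vector at (s, t) whose entries are not
-- forbidden by r; the 2^(m-3) admissible w carrying it at (s, t) are marked after extension,
-- which lowers the bound by 2^(m-3).
module Submission where

open import Defs
open import Data.Nat using (ℕ; zero; suc; _≤_; _<_; _+_; _*_; _∸_; _^_; z≤n; s≤s)
open import Data.Nat.Properties
  using ( ≤-refl; ≤-trans; ≤-reflexive; <⇒≤; ≤⇒≯; m+n≤o⇒m≤o∸n; module ≤-Reasoning
        ; +-mono-≤; +-monoˡ-≤; +-monoʳ-≤; *-mono-≤; *-monoˡ-≤; *-monoʳ-≤
        ; +-identityʳ; *-identityˡ; +-suc; +-assoc; +-*-semiring; *-1-commutativeMonoid )
open import Data.Nat.Tactic.RingSolver using (solve-∀)
open import Data.Bool using (Bool; true; false; _∧_; _∨_; not; T)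
open import Data.Bool.Properties using (T-∧; T-∨; T-not-≡)
open import Data.Fin as Fin using (Fin; zero; suc; punchIn; punchOut; _≟_)
open import Data.Fin.Properties as FinP using (punchIn-punchOut; punchInᵢ≢i; punchIn-injective)
open import Data.Fin.Patterns using (0F; 1F; 2F)
open import Data.Vec using ([]; _∷_; lookup; insertAt)
open import Data.Vec.Properties using (insertAt-lookup; insertAt-punchIn; ≡-dec)
open import Data.List using (List; []; _∷_; length; filter)
open import Data.List.Relation.Unary.All as All using (All; []; _∷_)
open import Data.List.Relation.Unary.All.Properties using (all-filter)
open import Data.List.Relation.Unary.AllPairs using ([]; _∷_)
open import Data.List.Relation.Unary.Unique.Propositional using (Unique)
open import Data.List.Relation.Unary.Unique.Propositional.Properties using (filter⁺)
open import Data.Product using (_×_; _,_; proj₁; proj₂; swap; ∃-syntax)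
open import Data.Sum using (_⊎_; inj₁; inj₂)
open import Data.Empty using (⊥; ⊥-elim)
open import Function using (_∘_; Equivalence)
open import Relation.Binary using (tri<; tri≈; tri>)
open import Relation.Binary.PropositionalEquality
open import Relation.Nullary using (¬_; Dec; yes; no; does; contradiction)
open import Relation.Nullary.Decidable using (isYes; isNo; toWitness; fromWitness; fromWitnessFalse; dec-false)
open import Algebra.Properties.Semiring.Sum +-*-semiring
  using (sum; sum-syntax; sum-cong-≗; ∑-distrib-+; ∑-comm; *-distribˡ-sum; *-distribʳ-sum)
open import Algebra.Properties.CommutativeMonoid.Sum *-1-commutativeMonoid
  using () renaming (sum to ∏; sum-remove to ∏-remove)

open Equivalence using (to; from)

𝟙 : Bool → ℕ
𝟙 false = 0
𝟙 true  = 1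

𝟙≤1 : ∀ a → 𝟙 a ≤ 1
𝟙≤1 false = z≤n
𝟙≤1 true  = ≤-refl

𝟙-mono-≤ : ∀ {a b} → (T a → T b) → 𝟙 a ≤ 𝟙 b
𝟙-mono-≤ {false} _   = z≤n
𝟙-mono-≤ {true} {true}  _   = ≤-refl
𝟙-mono-≤ {true} {false} a⇒b = ⊥-elim (a⇒b _)

𝟙-∧ : ∀ a b → 𝟙 (a ∧ b) ≡ 𝟙 a * 𝟙 b
𝟙-∧ false b = refl
𝟙-∧ true  b = sym (+-identityʳ (𝟙 b))

𝟙-∨-∧ : ∀ a b → 𝟙 a + 𝟙 b ≡ 𝟙 (a ∨ b) + 𝟙 (a ∧ b)
𝟙-∨-∧ true  b     = refl
𝟙-∨-∧ false false = refl
𝟙-∨-∧ false true  = refl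

𝟙-split : ∀ a b → 𝟙 (a ∧ not b) + 𝟙 (a ∧ b) ≡ 𝟙 a
𝟙-split false b     = refl
𝟙-split true  false = refl
𝟙-split true  true  = refl

∑-mono-≤ : ∀ {k} {f g : Fin k → ℕ} → (∀ i → f i ≤ g i) → sum f ≤ sum g
∑-mono-≤ {zero}  _   = z≤n
∑-mono-≤ {suc k} f≤g = +-mono-≤ (f≤g zero) (∑-mono-≤ (f≤g ∘ suc))

cubeSum : ∀ n → (Column n → ℕ) → ℕ
cubeSum zero    f = f []
cubeSum (suc n) f = ∑[ x < 3 ] cubeSum n (λ w → f (x ∷ w))

cubeSum-cong : ∀ n {f g : Column n → ℕ} → (∀ w → f w ≡ g w) → cubeSum n f ≡ cubeSum n g
cubeSum-cong zero    f≗g = f≗g []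
cubeSum-cong (suc n) f≗g = sum-cong-≗ (λ x → cubeSum-cong n (f≗g ∘ (x ∷_)))

cubeSum-mono-≤ : ∀ n {f g : Column n → ℕ} → (∀ w → f w ≤ g w) → cubeSum n f ≤ cubeSum n g
cubeSum-mono-≤ zero    f≤g = f≤g []
cubeSum-mono-≤ (suc n) f≤g = ∑-mono-≤ (λ x → cubeSum-mono-≤ n (f≤g ∘ (x ∷_)))

cubeSum-distrib-+ : ∀ n (f g : Column n → ℕ) →
                    cubeSum n (λ w → f w + g w) ≡ cubeSum n f + cubeSum n g
cubeSum-distrib-+ zero    f g = refl
cubeSum-distrib-+ (suc n) f g =
  trans (sum-cong-≗ (λ x → cubeSum-distrib-+ n (f ∘ (x ∷_)) (g ∘ (x ∷_))))
        (∑-distrib-+ (λ x → cubeSum n (f ∘ (x ∷_))) (λ x → cubeSum n (g ∘ (x ∷_))))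

*-distribˡ-cubeSum : ∀ n c (f : Column n → ℕ) → c * cubeSum n f ≡ cubeSum n (λ w → c * f w)
*-distribˡ-cubeSum zero    c f = refl
*-distribˡ-cubeSum (suc n) c f =
  trans (*-distribˡ-sum c (λ x → cubeSum n (f ∘ (x ∷_))))
        (sum-cong-≗ (λ x → *-distribˡ-cubeSum n c (f ∘ (x ∷_))))

cubeSum-insertAt : ∀ n (r : Fin (suc n)) (f : Column (suc n) → ℕ) →
                   cubeSum (suc n) f ≡ ∑[ x < 3 ] cubeSum n (λ w → f (insertAt w r x))
cubeSum-insertAt n       zero    f = refl
cubeSum-insertAt (suc n) (suc r) f = begin
  ∑[ y < 3 ] cubeSum (suc n) (λ w → f (y ∷ w))
    ≡⟨ sum-cong-≗ (λ y → cubeSum-insertAt n r (f ∘ (y ∷_))) ⟩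
  ∑[ y < 3 ] ∑[ x < 3 ] cubeSum n (λ w → f (y ∷ insertAt w r x))
    ≡⟨ ∑-comm (λ y x → cubeSum n (λ w → f (y ∷ insertAt w r x))) ⟩
  ∑[ x < 3 ] ∑[ y < 3 ] cubeSum n (λ w → f (y ∷ insertAt w r x))
    ∎
  where open ≡-Reasoning

card : ∀ n → (Column n → Bool) → ℕ
card n P = cubeSum n (𝟙 ∘ P)

card-mono-≤ : ∀ n {P Q : Column n → Bool} → (∀ w → T (P w) → T (Q w)) → card n P ≤ card n Q
card-mono-≤ n P⊆Q = cubeSum-mono-≤ n (λ w → 𝟙-mono-≤ (P⊆Q w))

card-∨-∧ : ∀ n (P Q : Column n → Bool) →
           card n P + card n Q ≡ card n (λ w → P w ∨ Q w) + card n (λ w → P w ∧ Q w)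
card-∨-∧ n P Q = begin
  card n P + card n Q                                   ≡⟨ cubeSum-distrib-+ n _ _ ⟨
  cubeSum n (λ w → 𝟙 (P w) + 𝟙 (Q w))                   ≡⟨ cubeSum-cong n (λ w → 𝟙-∨-∧ (P w) (Q w)) ⟩
  cubeSum n (λ w → 𝟙 (P w ∨ Q w) + 𝟙 (P w ∧ Q w))       ≡⟨ cubeSum-distrib-+ n _ _ ⟩
  card n (λ w → P w ∨ Q w) + card n (λ w → P w ∧ Q w)   ∎
  where open ≡-Reasoning

card-split : ∀ n (P Q : Column n → Bool) →
             card n (λ w → P w ∧ not (Q w)) + card n (λ w → P w ∧ Q w) ≡ card n P
card-split n P Q =
  trans (sym (cubeSum-distrib-+ n _ _)) (cubeSum-cong n (λ w → 𝟙-split (P w) (Q w)))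

_≟ᵥ_ : ∀ {n} (v w : Column n) → Dec (v ≡ w)
_≟ᵥ_ = ≡-dec _≟_

card-remove : ∀ n (P : Column n → Bool) {v} → T (P v) →
              card n P ≡ suc (card n (λ w → not (does (w ≟ᵥ v)) ∧ P w))
card-remove zero    P {[]}    Pv with P [] | Pv
... | true | _ = refl
card-remove (suc n) P {x ∷ v} Pv = removeHead x (card-remove n (P ∘ (x ∷_)) Pv)
  where
  A : Fin 3 → ℕ
  A y = card n (P ∘ (y ∷_))
  removeHead : ∀ x → A x ≡ suc (card n (λ w → not (does (w ≟ᵥ v)) ∧ P (x ∷ w))) →
               card (suc n) P ≡ suc (card (suc n) (λ w → not (does (w ≟ᵥ (x ∷ v))) ∧ P w))
  removeHead 0F eq = cong (_+ (A 1F + (A 2F + 0))) eq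
  removeHead 1F eq = trans (cong (λ c → A 0F + (c + (A 2F + 0))) eq) (+-suc (A 0F) _)
  removeHead 2F eq = begin
    A 0F + (A 1F + (A 2F + 0))          ≡⟨ cong (λ c → A 0F + (A 1F + (c + 0))) eq ⟩
    A 0F + (A 1F + suc (_ + 0))         ≡⟨ cong (A 0F +_) (+-suc (A 1F) _) ⟩
    A 0F + suc (A 1F + (_ + 0))         ≡⟨ +-suc (A 0F) _ ⟩
    suc (A 0F + (A 1F + (_ + 0)))       ∎
    where open ≡-Reasoning

≢⇒T-not-≟ᵥ : ∀ {n} {w v : Column n} → w ≢ v → T (not (does (w ≟ᵥ v)))
≢⇒T-not-≟ᵥ {w = w} {v} w≢v = from T-not-≡ (dec-false (w ≟ᵥ v) w≢v)

length-≤-card : ∀ n {P : Column n → Bool} (L : List (Column n)) →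
                Unique L → All (T ∘ P) L → length L ≤ card n P
length-≤-card n     []      _                _         = z≤n
length-≤-card n {P} (v ∷ L) (v∉L ∷ L-unique) (Pv ∷ PL) = begin
  suc (length L)  ≤⟨ s≤s (length-≤-card n L L-unique (All.zipWith P-without-v (v∉L , PL))) ⟩
  suc (card n _)  ≡⟨ card-remove n P Pv ⟨
  card n P        ∎
  where
  open ≤-Reasoning
  P-without-v : ∀ {w} → v ≢ w × T (P w) → T (not (does (w ≟ᵥ v)) ∧ P w)
  P-without-v {w} (v≢w , Pw) = from (T-∧ {not (does (w ≟ᵥ v))}) (≢⇒T-not-≟ᵥ (v≢w ∘ sym) , Pw)

box : ∀ {n} → (Fin n → Fin 3 → Bool) → Column n → Bool
box S []      = true
box S (x ∷ w) = S zero x ∧ box (S ∘ suc) w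

box⁺ : ∀ {n} (S : Fin n → Fin 3 → Bool) w → (∀ j → T (S j (lookup w j))) → T (box S w)
box⁺ S []      _ = _
box⁺ S (x ∷ w) h = from (T-∧ {S zero x}) (h zero , box⁺ (S ∘ suc) w (h ∘ suc))

box⁻ : ∀ {n} (S : Fin n → Fin 3 → Bool) w → T (box S w) → ∀ j → T (S j (lookup w j))
box⁻ S (x ∷ w) h zero    = proj₁ (to (T-∧ {S zero x}) h)
box⁻ S (x ∷ w) h (suc j) = box⁻ (S ∘ suc) w (proj₂ (to (T-∧ {S zero x}) h)) j

size : (Fin 3 → Bool) → ℕ
size S = ∑[ x < 3 ] 𝟙 (S x)

card-box : ∀ n (S : Fin n → Fin 3 → Bool) → card n (box S) ≡ ∏ (λ j → size (S j))
card-box zero    S = refl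
card-box (suc n) S = begin
  ∑[ x < 3 ] cubeSum n (λ w → 𝟙 (S zero x ∧ box S′ w))
    ≡⟨ sum-cong-≗ (λ x → cubeSum-cong n (λ w → 𝟙-∧ (S zero x) (box S′ w))) ⟩
  ∑[ x < 3 ] cubeSum n (λ w → 𝟙 (S zero x) * 𝟙 (box S′ w))
    ≡⟨ sum-cong-≗ (λ x → *-distribˡ-cubeSum n (𝟙 (S zero x)) (𝟙 ∘ box S′)) ⟨
  ∑[ x < 3 ] (𝟙 (S zero x) * card n (box S′))
    ≡⟨ *-distribʳ-sum (card n (box S′)) (𝟙 ∘ S zero) ⟨
  size (S zero) * card n (box S′)
    ≡⟨ cong (size (S zero) *_) (card-box n S′) ⟩
  size (S zero) * ∏ (λ j → size (S′ j))
    ∎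
  where
  open ≡-Reasoning
  S′ = S ∘ suc

size-≡ : ∀ u → size (λ x → isYes (x ≟ u)) ≡ 1
size-≡ 0F   = refl
size-≡ 1F   = refl
size-≡ 2F   = refl

size-≢ : ∀ u → size (λ x → isNo (x ≟ u)) ≡ 2
size-≢ 0F   = refl
size-≢ 1F   = refl
size-≢ 2F   = refl

^-≤-∏ : ∀ {n} k (f : Fin n → ℕ) → (∀ j → k ≤ f j) → k ^ n ≤ ∏ f
^-≤-∏ {zero}  k f _   = ≤-refl
^-≤-∏ {suc n} k f k≤f = *-mono-≤ (k≤f zero) (^-≤-∏ k (f ∘ suc) (k≤f ∘ suc))

∏-≤-^ : ∀ {n} k (f : Fin n → ℕ) → (∀ j → f j ≤ k) → ∏ f ≤ k ^ n
∏-≤-^ {zero}  k f _   = ≤-refl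
∏-≤-^ {suc n} k f f≤k = *-mono-≤ (f≤k zero) (∏-≤-^ k (f ∘ suc) (f≤k ∘ suc))

∏-removeAt-≤ : ∀ {n} (f : Fin (suc n) → ℕ) i → 1 ≤ f i → ∏ (f ∘ punchIn i) ≤ ∏ f
∏-removeAt-≤ f i 1≤fi = begin
  ∏ (f ∘ punchIn i)        ≡⟨ *-identityˡ _ ⟨
  1 * ∏ (f ∘ punchIn i)    ≤⟨ *-monoˡ-≤ _ 1≤fi ⟩
  f i * ∏ (f ∘ punchIn i)  ≡⟨ ∏-remove {i = i} f ⟨
  ∏ f                      ∎
  where open ≤-Reasoning

2^∸2-≤-∏ : ∀ {n} (f : Fin n → ℕ) {s t} → s ≢ t → (∀ j → 1 ≤ f j) →
           (∀ j → j ≢ s → j ≢ t → 2 ≤ f j) → 2 ^ (n ∸ 2) ≤ ∏ f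
2^∸2-≤-∏ {suc zero} f {zero} {zero} s≢t _ _ = contradiction refl s≢t
2^∸2-≤-∏ {suc (suc n)} f {s} {t} s≢t 1≤f 2≤f = begin
  2 ^ n                          ≤⟨ ^-≤-∏ 2 _ (λ j → 2≤f _ (punchInᵢ≢i s _) (≢t j)) ⟩
  ∏ (f ∘ punchIn s ∘ punchIn t′)  ≤⟨ ∏-removeAt-≤ (f ∘ punchIn s) t′ (1≤f _) ⟩
  ∏ (f ∘ punchIn s)              ≤⟨ ∏-removeAt-≤ f s (1≤f s) ⟩
  ∏ f                            ∎
  where
  open ≤-Reasoning
  t′ : Fin (suc n)
  t′ = punchOut s≢t
  ≢t : ∀ j → punchIn s (punchIn t′ j) ≢ t
  ≢t j eq = punchInᵢ≢i t′ j (punchIn-injective s _ _ (trans eq (sym (punchIn-punchOut s≢t))))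

unmarked : ∀ {m} → Assoc m → Column m → Bool
unmarked σ v = isYes (noMark? σ v)

oriented : ∀ {m} → Assoc m → Fin m → Fin m → Bool × Bool
oriented σ a b with a Fin.<? b
... | yes _ = σ a b
... | no  _ = swap (σ b a)

oriented-< : ∀ {m} (σ : Assoc m) {a b} → a Fin.< b → oriented σ a b ≡ σ a b
oriented-< σ {a} {b} a<b with a Fin.<? b
... | yes _   = refl
... | no  a≮b = contradiction a<b a≮b

oriented-> : ∀ {m} (σ : Assoc m) {a b} → b Fin.< a → oriented σ a b ≡ swap (σ b a)
oriented-> σ {a} {b} b<a with a Fin.<? b
... | yes a<b = contradiction b<a (FinP.<-asym a<b)
... | no  _   = refl

oriented-swap : ∀ {m} (σ : Assoc m) {a b} → a ≢ b → oriented σ b a ≡ swap (oriented σ a b)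
oriented-swap σ {a} {b} a≢b with FinP.<-cmp a b
... | tri< a<b _ _ rewrite oriented-< σ a<b | oriented-> σ a<b = refl
... | tri≈ _ a≡b _ = contradiction a≡b a≢b
... | tri> _ _ b<a rewrite oriented-< σ b<a | oriented-> σ b<a = refl

Edge⇒oriented : ∀ {m} (σ : Assoc m) {a b} → Edge σ a b → oriented σ a b ≡ (false , true)
Edge⇒oriented σ (inj₁ (a<b , σab)) = trans (oriented-< σ a<b) σab
Edge⇒oriented σ (inj₂ (b<a , σba)) = trans (oriented-> σ b<a) (cong swap σba)

oriented⇒Edge : ∀ {m} (σ : Assoc m) {a b} → a ≢ b → oriented σ a b ≡ (false , true) → Edge σ a b
oriented⇒Edge σ {a} {b} a≢b eq with FinP.<-cmp a b
... | tri< a<b _ _ = inj₁ (a<b , trans (sym (oriented-< σ a<b)) eq)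
... | tri≈ _ a≡b _ = contradiction a≡b a≢b
... | tri> _ _ b<a = inj₂ (b<a , cong swap (trans (sym (oriented-> σ b<a)) eq))

NoMark-oriented : ∀ {m} {σ : Assoc m} {v a b} → NoMark σ v → a ≢ b →
                  lookup v a ≡ bit (proj₁ (oriented σ a b)) →
                  lookup v b ≡ bit (proj₂ (oriented σ a b)) → ⊥
NoMark-oriented {σ = σ} {a = a} {b} noMark a≢b va vb with FinP.<-cmp a b
... | tri< a<b _ _ rewrite oriented-< σ a<b = noMark a b a<b (va , vb)
... | tri≈ _ a≡b _ = a≢b a≡b
... | tri> _ _ b<a rewrite oriented-> σ b<a = noMark b a b<a (vb , va)

deleteRow : ∀ {n} → Assoc (suc n) → Fin (suc n) → Assoc n
deleteRow σ r a b = σ (punchIn r a) (punchIn r b)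

punchIn-mono-< : ∀ {n} (r : Fin (suc n)) {a b : Fin n} → a Fin.< b → punchIn r a Fin.< punchIn r b
punchIn-mono-< r {a} {b} a<b =
  FinP.≤∧≢⇒< (FinP.punchIn-mono-≤ r a b (<⇒≤ a<b))
             (FinP.<⇒≢ a<b ∘ punchIn-injective r a b)

unmarked-insertAt : ∀ {n} (σ : Assoc (suc n)) r x w →
                    T (unmarked σ (insertAt w r x)) → T (unmarked (deleteRow σ r) w)
unmarked-insertAt σ r x w h = fromWitness λ a b a<b (wa , wb) →
  toWitness h (punchIn r a) (punchIn r b) (punchIn-mono-< r a<b)
    (trans (insertAt-punchIn w r x a) wa , trans (insertAt-punchIn w r x b) wb)

unmarked₀₁ : ∀ {n} → Assoc (suc n) → Fin (suc n) → Column n → Bool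
unmarked₀₁ σ r w = unmarked σ (insertAt w r (bit false)) ∧ unmarked σ (insertAt w r (bit true))

unmarked₀₁⇒NoMark : ∀ {n} (σ : Assoc (suc n)) r w → T (unmarked₀₁ σ r w) →
                    ∀ b → NoMark σ (insertAt w r (bit b))
unmarked₀₁⇒NoMark σ r w h b with to (T-∧ {unmarked σ (insertAt w r (bit false))}) h
unmarked₀₁⇒NoMark σ r w h false | h₀ , _ = toWitness h₀
unmarked₀₁⇒NoMark σ r w h true  | _ , h₁ = toWitness h₁

forbidden : ∀ {n} → Assoc (suc n) → Fin (suc n) → Fin n → Fin 3
forbidden σ r j = bit (proj₂ (oriented σ r (punchIn r j)))

allowed : ∀ {n} → Assoc (suc n) → Fin (suc n) → Fin n → Fin 3 → Bool
allowed σ r j x = isNo (x ≟ forbidden σ r j)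

-- Extending w at r by the first entry of the vector of (r, j) would complete a mark at (r, j).
unmarked₀₁⇒allowed : ∀ {n} (σ : Assoc (suc n)) r w → T (unmarked₀₁ σ r w) →
                     T (box (allowed σ r) w)
unmarked₀₁⇒allowed σ r w h = box⁺ (allowed σ r) w λ j →
  fromWitnessFalse {a? = lookup w j ≟ forbidden σ r j} λ wj≡forbidden →
    NoMark-oriented {v = insertAt w r _}
      (unmarked₀₁⇒NoMark σ r w h (proj₁ (oriented σ r (punchIn r j))))
      (punchInᵢ≢i r j ∘ sym) (insertAt-lookup w r _) (trans (insertAt-punchIn w r _ j) wj≡forbidden)

card-allowed-≤ : ∀ n (σ : Assoc (suc n)) r → card n (box (allowed σ r)) ≤ 2 ^ n
card-allowed-≤ n σ r = begin
  card n (box (allowed σ r))        ≡⟨ card-box n (allowed σ r) ⟩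
  ∏ (λ j → size (allowed σ r j))    ≤⟨ ∏-≤-^ 2 _ (λ j → ≤-reflexive (size-≢ (forbidden σ r j))) ⟩
  2 ^ n                             ∎
  where open ≤-Reasoning

card-unmarked-step : ∀ n (σ : Assoc (suc n)) r →
  card (suc n) (unmarked σ) ≤ 2 * card n (unmarked (deleteRow σ r)) + card n (unmarked₀₁ σ r)
card-unmarked-step n σ r = begin
  card (suc n) (unmarked σ)
    ≡⟨ cubeSum-insertAt n r (𝟙 ∘ unmarked σ) ⟩
  U 0F + (U 1F + (U 2F + 0))
    ≡⟨ reassociate (U 0F) (U 1F) (U 2F) ⟩
  (U 0F + U 1F) + U 2F
    ≡⟨ cong (_+ U 2F) (card-∨-∧ n (extension 0F) (extension 1F)) ⟩
  (card n (λ w → extension 0F w ∨ extension 1F w) + card n (unmarked₀₁ σ r))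
    + U 2F
    ≤⟨ +-mono-≤ (+-monoˡ-≤ _ (card-mono-≤ n restrict₀₁)) (card-mono-≤ n (restrict 2F)) ⟩
  (C + card n (unmarked₀₁ σ r)) + C
    ≡⟨ double C (card n (unmarked₀₁ σ r)) ⟩
  2 * C + card n (unmarked₀₁ σ r)
    ∎
  where
  open ≤-Reasoning
  extension : Fin 3 → Column n → Bool
  extension x w = unmarked σ (insertAt w r x)
  U : Fin 3 → ℕ
  U x = card n (extension x)
  C : ℕ
  C = card n (unmarked (deleteRow σ r))
  restrict : ∀ x w → T (extension x w) → T (unmarked (deleteRow σ r) w)
  restrict x w = unmarked-insertAt σ r x w
  restrict₀₁ : ∀ w → T (extension 0F w ∨ extension 1F w) → T (unmarked (deleteRow σ r) w)
  restrict₀₁ w h with to (T-∨ {extension 0F w}) h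
  ... | inj₁ h₀ = restrict 0F w h₀
  ... | inj₂ h₁ = restrict 1F w h₁
  reassociate : ∀ a b c → a + (b + (c + 0)) ≡ (a + b) + c
  reassociate = solve-∀
  double : ∀ c j → (c + j) + c ≡ 2 * c + j
  double = solve-∀

unmarkedBound : ℕ → ℕ
unmarkedBound m = 2 ^ m + m * 2 ^ (m ∸ 1)

unmarkedBound-suc : ∀ n → unmarkedBound (suc n) ≡ 2 * unmarkedBound n + 2 ^ n
unmarkedBound-suc zero    = refl
unmarkedBound-suc (suc n) = identity n (2 ^ n)
  where
  identity : ∀ n e → 2 * (2 * e) + suc (suc n) * (2 * e) ≡ 2 * (2 * e + suc n * e) + 2 * e
  identity = solve-∀

card-unmarked-≤ : ∀ n (σ : Assoc n) → card n (unmarked σ) ≤ unmarkedBound n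
card-unmarked-≤ zero    σ = 𝟙≤1 _
card-unmarked-≤ (suc n) σ = begin
  card (suc n) (unmarked σ)
    ≤⟨ card-unmarked-step n σ zero ⟩
  2 * card n (unmarked (deleteRow σ zero)) + card n (unmarked₀₁ σ zero)
    ≤⟨ +-mono-≤ (*-monoʳ-≤ 2 (card-unmarked-≤ n _))
                (≤-trans (card-mono-≤ n (unmarked₀₁⇒allowed σ zero)) (card-allowed-≤ n σ zero)) ⟩
  2 * unmarkedBound n + 2 ^ n
    ≡⟨ unmarkedBound-suc n ⟨
  unmarkedBound (suc n)
    ∎
  where open ≤-Reasoning

-- The entries of the vector of (s, t) are not forbidden by r at s and at t.
record Obstruction {m} (σ : Assoc m) (r s t : Fin m) : Set where
  field
    r≢s : r ≢ s
    r≢t : r ≢ t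
    s≢t : s ≢ t
    allowed-at-s : proj₁ (oriented σ s t) ≢ proj₂ (oriented σ r s)
    allowed-at-t : proj₂ (oriented σ s t) ≢ proj₂ (oriented σ r t)

edge-or-obstruction : ∀ {m} (σ : Assoc m) {i j k} → i ≢ j → j ≢ k → i ≢ k →
                      Edge σ i j → Edge σ j k →
                      Edge σ i k ⊎ ∃[ r ] ∃[ s ] ∃[ t ] Obstruction σ r s t
edge-or-obstruction σ {i} {j} {k} i≢j j≢k i≢k ij jk with oriented σ i k in ik
... | (false , true) = inj₁ (oriented⇒Edge σ i≢k ik)
... | (_ , false) = inj₂ (i , j , k , record
  { r≢s = i≢j ; r≢t = i≢k ; s≢t = j≢k
  ; allowed-at-s = subst₂ _≢_ (sym (cong proj₁ (Edge⇒oriented σ jk)))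
                              (sym (cong proj₂ (Edge⇒oriented σ ij))) λ ()
  ; allowed-at-t = subst₂ _≢_ (sym (cong proj₂ (Edge⇒oriented σ jk))) (sym (cong proj₂ ik)) λ ()
  })
... | (true , true) = inj₂ (k , i , j , record
  { r≢s = i≢k ∘ sym ; r≢t = j≢k ∘ sym ; s≢t = i≢j
  ; allowed-at-s = subst₂ _≢_ (sym (cong proj₁ (Edge⇒oriented σ ij)))
                              (sym (trans (cong proj₂ (oriented-swap σ i≢k)) (cong proj₁ ik))) λ ()
  ; allowed-at-t = subst₂ _≢_ (sym (cong proj₂ (Edge⇒oriented σ ij)))
                              (sym (trans (cong proj₂ (oriented-swap σ j≢k))
                                          (cong proj₁ (Edge⇒oriented σ jk)))) λ ()
  })

pin : ∀ {n} → Fin n → Fin 3 → (Fin n → Fin 3 → Bool) → Fin n → Fin 3 → Bool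
pin s u S j x with j ≟ s
... | yes _ = isYes (x ≟ u)
... | no  _ = S j x

pin-at : ∀ {n} {s : Fin n} {u S x} → T (pin s u S s x) → x ≡ u
pin-at {s = s} h with s ≟ s
... | yes _   = toWitness h
... | no  s≢s = contradiction refl s≢s

pin-≢ : ∀ {n} {s j : Fin n} {u S x} → j ≢ s → pin s u S j x ≡ S j x
pin-≢ {s = s} {j} j≢s with j ≟ s
... | yes j≡s = contradiction j≡s j≢s
... | no  _   = refl

pin-⊆ : ∀ {n} {s : Fin n} {u S} → T (S s u) → ∀ j x → T (pin s u S j x) → T (S j x)
pin-⊆ {s = s} {S = S} Su j x h with j ≟ s
... | yes refl = subst (T ∘ S j) (sym (toWitness h)) Su
... | no  _    = h

size-pin-≢ : ∀ {n} {s j : Fin n} {u S} → j ≢ s → size (pin s u S j) ≡ size (S j)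
size-pin-≢ {u = u} {S} j≢s = sum-cong-≗ (λ x → cong 𝟙 (pin-≢ {u = u} {S} {x} j≢s))

1≤size-pin : ∀ {n} {s : Fin n} {u S} j → 1 ≤ size (S j) → 1 ≤ size (pin s u S j)
1≤size-pin {s = s} {u} j h with j ≟ s
... | yes _ = ≤-reflexive (sym (size-≡ u))
... | no  _ = h

bit-injective : ∀ {a b} → bit a ≡ bit b → a ≡ b
bit-injective {false} {false} _ = refl
bit-injective {true}  {true}  _ = refl

¬T⇒T-not : ∀ {b} → ¬ T b → T (not b)
¬T⇒T-not {false} _  = _
¬T⇒T-not {true}  ¬b = ¬b _

module _ {n} (σ : Assoc (suc n)) {r s t} (obs : Obstruction σ r s t) where
  open Obstruction obs

  private
    s′ t′ : Fin n
    s′ = punchOut r≢s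
    t′ = punchOut r≢t

    s′≢t′ : s′ ≢ t′
    s′≢t′ = s≢t ∘ FinP.punchOut-injective r≢s r≢t

    u v : Fin 3
    u = bit (proj₁ (oriented σ s t))
    v = bit (proj₂ (oriented σ s t))

    forbidden-at : ∀ {a} (r≢a : r ≢ a) → forbidden σ r (punchOut r≢a) ≡ bit (proj₂ (oriented σ r a))
    forbidden-at r≢a = cong (λ a → bit (proj₂ (oriented σ r a))) (punchIn-punchOut r≢a)

    u-allowed : T (allowed σ r s′ u)
    u-allowed = fromWitnessFalse {a? = u ≟ forbidden σ r s′}
      λ eq → allowed-at-s (bit-injective (trans eq (forbidden-at r≢s)))

    v-allowed : T (allowed σ r t′ v)
    v-allowed = fromWitnessFalse {a? = v ≟ forbidden σ r t′}
      λ eq → allowed-at-t (bit-injective (trans eq (forbidden-at r≢t)))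

    patterned : Fin n → Fin 3 → Bool
    patterned = pin s′ u (pin t′ v (allowed σ r))

    patterned⇒allowed : ∀ w → T (box patterned w) → T (box (allowed σ r) w)
    patterned⇒allowed w h = box⁺ (allowed σ r) w λ j →
      pin-⊆ v-allowed j _ (pin-⊆ (subst T (sym (pin-≢ s′≢t′)) u-allowed) j _ (box⁻ patterned w h j))

    patterned⇒marked : ∀ w → T (box patterned w) → ¬ T (unmarked₀₁ σ r w)
    patterned⇒marked w h h₀₁ =
      NoMark-oriented {v = insertAt w r (bit false)} (unmarked₀₁⇒NoMark σ r w h₀₁ false) s≢t
        (subst (λ a → lookup (insertAt w r _) a ≡ u) (punchIn-punchOut r≢s)
          (trans (insertAt-punchIn w r _ s′) (pin-at {s = s′} {S = pin t′ v (allowed σ r)} (box⁻ patterned w h s′))))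
        (subst (λ a → lookup (insertAt w r _) a ≡ v) (punchIn-punchOut r≢t)
          (trans (insertAt-punchIn w r _ t′)
            (pin-at {s = t′} {S = allowed σ r} (subst T (pin-≢ (s′≢t′ ∘ sym)) (box⁻ patterned w h t′)))))

    card-patterned : 2 ^ (n ∸ 2) ≤ card n (box patterned)
    card-patterned = begin
      2 ^ (n ∸ 2)                      ≤⟨ 2^∸2-≤-∏ (size ∘ patterned) s′≢t′ one two ⟩
      ∏ (λ j → size (patterned j))     ≡⟨ card-box n patterned ⟨
      card n (box patterned)           ∎
      where
      open ≤-Reasoning
      one : ∀ j → 1 ≤ size (patterned j)
      one j = 1≤size-pin j (1≤size-pin j (≤-trans (s≤s z≤n) (≤-reflexive (sym (size-≢ (forbidden σ r j))))))
      two : ∀ j → j ≢ s′ → j ≢ t′ → 2 ≤ size (patterned j)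
      two j j≢s′ j≢t′ =
        ≤-reflexive (sym (trans (size-pin-≢ j≢s′) (trans (size-pin-≢ j≢t′) (size-≢ (forbidden σ r j)))))

  card-unmarked₀₁-strict : card n (unmarked₀₁ σ r) + 2 ^ (n ∸ 2) ≤ 2 ^ n
  card-unmarked₀₁-strict = begin
    card n (unmarked₀₁ σ r) + 2 ^ (n ∸ 2)
      ≤⟨ +-monoʳ-≤ _ card-patterned ⟩
    card n (unmarked₀₁ σ r) + card n (box patterned)
      ≤⟨ +-mono-≤ (card-mono-≤ n (λ w h → from (T-∧ {box (allowed σ r) w})
                                    (unmarked₀₁⇒allowed σ r w h , ¬T⇒T-not (λ p → patterned⇒marked w p h))))
                  (card-mono-≤ n (λ w h → from (T-∧ {box (allowed σ r) w}) (patterned⇒allowed w h , h))) ⟩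
    card n (λ w → box (allowed σ r) w ∧ not (box patterned w))
      + card n (λ w → box (allowed σ r) w ∧ box patterned w)
      ≡⟨ card-split n (box (allowed σ r)) (box patterned) ⟩
    card n (box (allowed σ r))
      ≤⟨ card-allowed-≤ n σ r ⟩
    2 ^ n
      ∎
    where open ≤-Reasoning

card-unmarked-strict : ∀ n (σ : Assoc (suc n)) {r s t} → Obstruction σ r s t →
                       card (suc n) (unmarked σ) + 2 ^ (n ∸ 2) ≤ unmarkedBound (suc n)
card-unmarked-strict n σ {r} obs = begin
  card (suc n) (unmarked σ) + 2 ^ (n ∸ 2)
    ≤⟨ +-monoˡ-≤ _ (card-unmarked-step n σ r) ⟩
  2 * card n (unmarked (deleteRow σ r)) + card n (unmarked₀₁ σ r) + 2 ^ (n ∸ 2)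
    ≡⟨ +-assoc (2 * card n (unmarked (deleteRow σ r))) _ _ ⟩
  2 * card n (unmarked (deleteRow σ r)) + (card n (unmarked₀₁ σ r) + 2 ^ (n ∸ 2))
    ≤⟨ +-mono-≤ (*-monoʳ-≤ 2 (card-unmarked-≤ n _)) (card-unmarked₀₁-strict σ obs) ⟩
  2 * unmarkedBound n + 2 ^ n
    ≡⟨ unmarkedBound-suc n ⟨
  unmarkedBound (suc n)
    ∎
  where open ≤-Reasoning

length-B-part-≤ : ∀ {m} (σ : Assoc m) (A : Matrix m) → Simple A →
                  length (B-part σ A) ≤ card m (unmarked σ)
length-B-part-≤ σ A A-simple = length-≤-card _ (B-part σ A) (filter⁺ (noMark? σ) A-simple)
  (All.map fromWitness (all-filter (noMark? σ) A))

lemma2 : (m a p d : ℕ) → 3 ≤ p → a ≤ p ∸ 1 → d ≤ p ∸ 1 → 3 ≤ m →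
         (A : Matrix m) → Simple A → ¬ ((a , p , p , d) ≺F A) →
         (σ : Assoc m) → ValidAssoc a p d A σ →
         2 ^ m + m * 2 ^ (m ∸ 1) ∸ 2 ^ (m ∸ 3) < length (B-part σ A) →
         TransitiveT σ
lemma2 zero _ _ _ _ _ _ ()
lemma2 (suc n) _ _ _ _ _ _ _ A A-simple _ σ _ B-large i j k i≢j j≢k i≢k ij jk
  with edge-or-obstruction σ i≢j j≢k i≢k ij jk
... | inj₁ ik = ik
... | inj₂ (_ , _ , _ , obs) = contradiction B-large (≤⇒≯ B-small)
  where
  B-small : length (B-part σ A) ≤ unmarkedBound (suc n) ∸ 2 ^ (n ∸ 2)
  B-small = m+n≤o⇒m≤o∸n _ (≤-trans (+-monoˡ-≤ _ (length-B-part-≤ σ A A-simple))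
                                   (card-unmarked-strict n σ obs))
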